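{- Let $m \geq 3$ be an integer, let $\mathcal{A}$ be a finite set with a strict linear order $<$, and let $\mathcal{B}$ be a weakly $(m-1)$-wise balanced design over $\mathcal{A}$. Then $\frac{|\mathcal{A}|}{|\mathcal{B}|} \leq \alpha(\Gamma_{\mathcal{B}, m})$.
   Context: For an integer $r \geq 2$ and a set $\mathcal{A}$ (whose elements are called points), a weakly $r$-wise balanced design over $\mathcal{A}$ is a family $\mathcal{B}$ of subsets of $\mathcal{A}$ (called blocks) such that: (1) any $r$ pairwise distinct points are contained together in at most one block; (2) every point lies in at least one block; (3) every block is non-empty. Given $m \geq 3$, a weakly $(m-1)$-wise balanced design $\mathcal{B}$ over $\mathcal{A}$, and a strict linear order $<$ on $\mathcal{A}$, the graph $\Gamma_{\mathcal{B}, m}$ has as vertices all incidence pairs $(x, B)$ with $B \in \mathcal{B}$ and $x \in B$; two vertices $(x, B_1)$ and $(y, B_2)$ are adjacent iff $x < y$, $B_1 \neq B_2$, and $x \in B_2$. $\alpha$ denotes the independence number. -}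

module Defs where

open import Level using (0ℓ)
open import Data.Nat using (ℕ; _∸_)
open import Data.Fin using (Fin)
open import Data.Fin.Subset using (Subset; _∈_)
open import Data.Product using (_×_; _,_; ∃)
open import Data.Sum using (_⊎_)
open import Data.List using (List; length)
open import Data.List.Relation.Unary.All using (All)
open import Data.List.Relation.Unary.Unique.Propositional using (Unique)
open import Data.List.Relation.Unary.AllPairs using (AllPairs)
open import Relation.Binary using (Rel)
open import Relation.Binary.PropositionalEquality using (_≡_; _≢_)
open import Relation.Nullary using (¬_)
open import Function.Definitions using (Injective)

-- Points: Fin n.  A family of b blocks: an injective map Fin b → Subset n
-- (injectivity = the blocks form a *set* of subsets, |𝓑| = b).
Family : ℕ → ℕ → Set
Family n b = Fin b → Subset n

record WeaklyBalanced (r n b : ℕ) (𝓑 : Family n b) : Set where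
  field
    distinctBlocks : Injective _≡_ _≡_ 𝓑
    atMostOne : (p : Fin r → Fin n) → Injective _≡_ _≡_ p →
                (i j : Fin b) →
                (∀ k → p k ∈ 𝓑 i) → (∀ k → p k ∈ 𝓑 j) → i ≡ j
    covering : (x : Fin n) → ∃ λ i → x ∈ 𝓑 i
    nonEmpty : (i : Fin b) → ∃ λ x → x ∈ 𝓑 i

-- Vertices of Γ_{𝓑,m}: incidence pairs (x , i) with x ∈ 𝓑 i.
Incidence : {n b : ℕ} → Family n b → Fin n × Fin b → Set
Incidence 𝓑 (x , i) = x ∈ 𝓑 i

Arc : {n b : ℕ} → Rel (Fin n) 0ℓ → Family n b → Fin n × Fin b → Fin n × Fin b → Set
Arc _<_ 𝓑 (x , i) (y , j) = (x < y) × (i ≢ j) × (x ∈ 𝓑 j)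

Adjacent : {n b : ℕ} → Rel (Fin n) 0ℓ → Family n b → Fin n × Fin b → Fin n × Fin b → Set
Adjacent _<_ 𝓑 u v = Arc _<_ 𝓑 u v ⊎ Arc _<_ 𝓑 v u

IsIndependent : {n b : ℕ} → Rel (Fin n) 0ℓ → Family n b → List (Fin n × Fin b) → Set
IsIndependent _<_ 𝓑 S =
  Unique S × All (Incidence 𝓑) S × AllPairs (λ u v → ¬ Adjacent _<_ 𝓑 u v) S

IsIndependenceNumber : {n b : ℕ} → Rel (Fin n) 0ℓ → Family n b → ℕ → Set
IsIndependenceNumber _<_ 𝓑 α =
  (∃ λ S → IsIndependent _<_ 𝓑 S × length S ≡ α) ×
  (∀ S → IsIndependent _<_ 𝓑 S → length S Data.Nat.≤ α)

{-# OPTIONS --safe #-}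
-- For each block B, the incidences (x , B) with x ∈ B are pairwise non-adjacent,
-- since adjacency requires two different blocks; hence |B| ≤ α. The blocks cover
-- the n points, so n ≤ Σ |B| ≤ b α.
module Submission where

open import Defs
open import Level using (0ℓ)
open import Data.Nat using (ℕ; _≤_; _*_; _∸_; _+_; suc; z≤n; s≤s)
open import Data.Nat.Properties using (≤-trans; +-mono-≤; +-suc; m≤n⇒m≤1+n; module ≤-Reasoning)
open import Data.Fin using (Fin; zero; suc)
open import Data.Fin.Properties using (suc-injective)
open import Data.Fin.Subset
  using (Subset; _∈_; _∪_; ⋃; ⊤; ∣_∣; inside; outside; _⊆_)
open import Data.Fin.Subset.Properties
  using (∣⊥∣≡0; ∣⊤∣≡n; p⊆q⇒∣p∣≤∣q∣; x∈p∪q⁺)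
open import Data.Vec using ([]; _∷_; here; there)
open import Data.List using (List; []; _∷_; map; length; tabulate)
open import Data.List.Properties using (length-map; length-tabulate)
open import Data.List.Relation.Unary.All as All using (All; []; _∷_)
import Data.List.Relation.Unary.All.Properties as All
open import Data.List.Relation.Unary.Any using (Any; here; there)
import Data.List.Relation.Unary.Any.Properties as Any
open import Data.List.Relation.Unary.AllPairs as AllPairs using ([]; _∷_)
import Data.List.Relation.Unary.AllPairs.Properties as AllPairs
open import Data.List.Relation.Unary.Unique.Propositional using (Unique)
import Data.List.Relation.Unary.Unique.Propositional.Properties as Unique
open import Data.Product using (_×_; _,_; proj₁; ∃)
open import Data.Sum using (inj₁; inj₂)
open import Relation.Binary using (Rel; IsStrictTotalOrder)
open import Relation.Binary.PropositionalEquality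
  using (_≡_; refl; sym; cong; subst; trans)
open import Relation.Nullary using (¬_)

private
  variable
    n b k : ℕ

toList : Subset n → List (Fin n)
toList []            = []
toList (inside  ∷ p) = zero ∷ map suc (toList p)
toList (outside ∷ p) = map suc (toList p)

length-toList : (p : Subset n) → length (toList p) ≡ ∣ p ∣
length-toList []            = refl
length-toList (inside  ∷ p) = cong suc (trans (length-map suc (toList p)) (length-toList p))
length-toList (outside ∷ p) = trans (length-map suc (toList p)) (length-toList p)

toList-∈ : (p : Subset n) → All (_∈ p) (toList p)
toList-∈ []            = []
toList-∈ (inside  ∷ p) = here ∷ All.map⁺ (All.map there (toList-∈ p))
toList-∈ (outside ∷ p) = All.map⁺ (All.map there (toList-∈ p))

toList-unique : (p : Subset n) → Unique (toList p)
toList-unique []            = []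
toList-unique (inside  ∷ p) =
  All.map⁺ (All.universal (λ _ ()) (toList p)) ∷ Unique.map⁺ suc-injective (toList-unique p)
toList-unique (outside ∷ p) = Unique.map⁺ suc-injective (toList-unique p)

∣p∪q∣≤∣p∣+∣q∣ : (p q : Subset n) → ∣ p ∪ q ∣ ≤ ∣ p ∣ + ∣ q ∣
∣p∪q∣≤∣p∣+∣q∣ []            []            = z≤n
∣p∪q∣≤∣p∣+∣q∣ (inside  ∷ p) (inside  ∷ q) =
  s≤s (subst (∣ p ∪ q ∣ ≤_) (sym (+-suc ∣ p ∣ ∣ q ∣)) (m≤n⇒m≤1+n (∣p∪q∣≤∣p∣+∣q∣ p q)))
∣p∪q∣≤∣p∣+∣q∣ (inside  ∷ p) (outside ∷ q) = s≤s (∣p∪q∣≤∣p∣+∣q∣ p q)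
∣p∪q∣≤∣p∣+∣q∣ (outside ∷ p) (inside  ∷ q) =
  subst (suc ∣ p ∪ q ∣ ≤_) (sym (+-suc ∣ p ∣ ∣ q ∣)) (s≤s (∣p∪q∣≤∣p∣+∣q∣ p q))
∣p∪q∣≤∣p∣+∣q∣ (outside ∷ p) (outside ∷ q) = ∣p∪q∣≤∣p∣+∣q∣ p q

x∈⋃⁺ : {x : Fin n} {ps : List (Subset n)} → Any (x ∈_) ps → x ∈ ⋃ ps
x∈⋃⁺ (here  x∈p)  = x∈p∪q⁺ (inj₁ x∈p)
x∈⋃⁺ (there x∈ps) = x∈p∪q⁺ (inj₂ (x∈⋃⁺ x∈ps))

∣⋃ps∣≤length*k : (ps : List (Subset n)) → All (λ p → ∣ p ∣ ≤ k) ps →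
                 ∣ ⋃ ps ∣ ≤ length ps * k
∣⋃ps∣≤length*k {n} []       []             = subst (_≤ 0) (sym (∣⊥∣≡0 n)) z≤n
∣⋃ps∣≤length*k     (p ∷ ps) (∣p∣≤k ∷ ∣ps∣≤k) =
  ≤-trans (∣p∪q∣≤∣p∣+∣q∣ p (⋃ ps)) (+-mono-≤ ∣p∣≤k (∣⋃ps∣≤length*k ps ∣ps∣≤k))

covering⇒n≤b*k : (f : Fin b → Subset n) → (∀ x → ∃ λ i → x ∈ f i) →
                 (∀ i → ∣ f i ∣ ≤ k) → n ≤ b * k
covering⇒n≤b*k {b} {n} {k} f covers ∣f∣≤k = begin
  n                          ≡⟨ ∣⊤∣≡n n ⟨
  ∣ ⊤ {n} ∣                  ≤⟨ p⊆q⇒∣p∣≤∣q∣ ⊤⊆⋃f ⟩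
  ∣ ⋃ (tabulate f) ∣         ≤⟨ ∣⋃ps∣≤length*k (tabulate f) (All.tabulate⁺ ∣f∣≤k) ⟩
  length (tabulate f) * k    ≡⟨ cong (_* k) (length-tabulate f) ⟩
  b * k                      ∎
  where
  open ≤-Reasoning
  ⊤⊆⋃f : ⊤ ⊆ ⋃ (tabulate f)
  ⊤⊆⋃f {x} _ = let i , x∈fi = covers x in x∈⋃⁺ (Any.tabulate⁺ i x∈fi)

module _ (_<_ : Rel (Fin n) 0ℓ) (𝓑 : Family n b) where

  sameBlock⇒¬Adjacent : ∀ {x y i} → ¬ Adjacent _<_ 𝓑 (x , i) (y , i)
  sameBlock⇒¬Adjacent (inj₁ (_ , i≢i , _)) = i≢i refl
  sameBlock⇒¬Adjacent (inj₂ (_ , i≢i , _)) = i≢i refl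

  blockVertices : Fin b → List (Fin n × Fin b)
  blockVertices i = map (_, i) (toList (𝓑 i))

  length-blockVertices : ∀ i → length (blockVertices i) ≡ ∣ 𝓑 i ∣
  length-blockVertices i = trans (length-map (_, i) (toList (𝓑 i))) (length-toList (𝓑 i))

  blockVertices-independent : ∀ i → IsIndependent _<_ 𝓑 (blockVertices i)
  blockVertices-independent i =
      Unique.map⁺ (cong proj₁) (toList-unique (𝓑 i))
    , All.map⁺ (toList-∈ (𝓑 i))
    , AllPairs.map⁺ (AllPairs.map (λ _ → sameBlock⇒¬Adjacent) (toList-unique (𝓑 i)))

theorem2p10 : (m : ℕ) → 3 ≤ m → (n : ℕ) → (_<_ : Rel (Fin n) 0ℓ) →
              IsStrictTotalOrder _≡_ _<_ → (b : ℕ) → (𝓑 : Family n b) →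
              WeaklyBalanced (m ∸ 1) n b 𝓑 → (α : ℕ) →
              IsIndependenceNumber _<_ 𝓑 α → n ≤ b * α
theorem2p10 _ _ n _<_ _ b 𝓑 design α (_ , maximal) =
  covering⇒n≤b*k 𝓑 (WeaklyBalanced.covering design) ∣block∣≤α
  where
  ∣block∣≤α : ∀ i → ∣ 𝓑 i ∣ ≤ α
  ∣block∣≤α i = subst (_≤ α) (length-blockVertices _<_ 𝓑 i)
                  (maximal (blockVertices _<_ 𝓑 i) (blockVertices-independent _<_ 𝓑 i))
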